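{- For $|q|<1$ define the Lambert series \[ f(q)=\sum_{n\ge1}n\frac{q^{n}}{1-q^{n}},\qquad g(q)=\sum_{n\ge1}n\frac{q^{n}}{1+q^{n}}. \] Then \[ f(q)=\sum_{j,k\ge0}2^{2j+k}\left[g\!\left(q^{2^{j+k}}\right)-4\,g\!\left(q^{2^{j+k+1}}\right)\right]. \] -}

module Defs where

open import Data.Nat as ℕ using (ℕ; zero; suc)
open import Data.Integer using (ℤ; +_; -_; _+_; _-_; _*_; _^_)
open import Data.Bool using (if_then_else_)
open import Relation.Nullary.Decidable using (⌊_⌋)

-- Formal power series over ℤ, as coefficient sequences: F N = [q^N] F.
FPS : Set
FPS = ℕ → ℤ

sumTo : ℕ → (ℕ → ℤ) → ℤ
sumTo zero    a = + 0
sumTo (suc n) a = sumTo n a + a n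

sumUpTo : ℕ → (ℕ → ℤ) → ℤ
sumUpTo N = sumTo (suc N)

ind : ℕ → ℕ → ℤ
ind a b = if ⌊ a ℕ.≟ b ⌋ then + 1 else + 0

-- Formal sum of a family of series F : ℕ → FPS in which F i has order ≥ i
-- (all coefficients of q^N with N < i vanish): [q^N] Σ_i F i = Σ_{i ≤ N} [q^N] F i.
fsum : (ℕ → FPS) → FPS
fsum F N = sumUpTo N (λ i → F i N)

-- Formal double sum of a family F j k in which F j k has order > max j k.
fsum2 : (ℕ → ℕ → FPS) → FPS
fsum2 F N = sumUpTo N (λ j → sumUpTo N (λ k → F j k N))

mono : ℕ → FPS
mono e N = ind e N

-- Geometric expansions, for n ≥ 1 (valid as formal series, |q| < 1):
--   q^n / (1 - q^n) = Σ_{m ≥ 0} q^{n(m+1)}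
--   q^n / (1 + q^n) = Σ_{m ≥ 0} (-1)^m q^{n(m+1)}
-- (the m-th term has order n(m+1) ≥ m, so fsum applies)
geomMinus : ℕ → FPS
geomMinus n = fsum (λ m → mono (n ℕ.* suc m))

geomPlus : ℕ → FPS
geomPlus n = fsum (λ m N → ((- + 1) ^ m) * mono (n ℕ.* suc m) N)

-- f(q) = Σ_{n ≥ 1} n q^n/(1-q^n)   (term n has order ≥ n)
f : FPS
f = fsum (λ i N → + i * (if ⌊ i ℕ.≟ 0 ⌋ then + 0 else geomMinus i N))

g : FPS
g = fsum (λ i N → + i * (if ⌊ i ℕ.≟ 0 ⌋ then + 0 else geomPlus i N))

-- substitution F(q^k) for k ≥ 1: [q^N] F(q^k) = Σ_{i ≤ N} [k i = N] [q^i] F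
substPow : ℕ → FPS → FPS
substPow k F N = sumUpTo N (λ i → ind (k ℕ.* i) N * F i)

-- Right-hand side: Σ_{j,k ≥ 0} 2^{2j+k} [ g(q^{2^{j+k}}) - 4 g(q^{2^{j+k+1}}) ]
-- (term (j,k) has order ≥ 2^{j+k} > max j k, so fsum2 applies)
rhs : FPS
rhs = fsum2 (λ j k N → ((+ 2) ^ (2 ℕ.* j ℕ.+ k)) *
                        (substPow (2 ℕ.^ (j ℕ.+ k)) g N
                         - + 4 * substPow (2 ℕ.^ (j ℕ.+ k ℕ.+ 1)) g N))

-- Since x/(1+x) = x/(1-x) - 2x²/(1-x²), one has g(q) = f(q) - 2 f(q²). Writing
-- B_s = f(q^{2^s}) and D_s = B_s - 4 B_{s+1}, the (j,k) summand of the right-hand side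
-- becomes 4^j 2^k (D_{j+k} - 2 D_{j+k+1}); the sum over k telescopes to 4^j D_j, and the
-- sum over j telescopes to B_0 = f(q). Coefficientwise everything is a finite computation,
-- because the coefficient of q^N in B_s vanishes as soon as 2^s > N.
module Submission where

open import Defs
open import Data.Nat as ℕ using (ℕ; zero; suc; z≤n; s≤s; NonZero; _≤′_; ≤′-refl; ≤′-step)
import Data.Nat.Properties as ℕ
open import Data.Integer using (ℤ; +_; -_; _+_; _-_; _*_; _^_)
import Data.Integer.Properties as ℤ
open import Data.Product using (_,_)
open import Function using (_∘_)
open import Data.Bool using (if_then_else_)
open import Relation.Nullary.Decidable using (⌊_⌋)
open import Relation.Nullary using (yes; no; contradiction)
open import Relation.Binary.PropositionalEquality
open import Data.Nat.Tactic.RingSolver as ℕ-Solver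
open import Data.Integer.Tactic.RingSolver as ℤ-Solver

open ≡-Reasoning

sumTo-cong : ∀ B {a b : ℕ → ℤ} → (∀ x → a x ≡ b x) → sumTo B a ≡ sumTo B b
sumTo-cong zero    a≡b = refl
sumTo-cong (suc B) a≡b = cong₂ _+_ (sumTo-cong B a≡b) (a≡b B)

sumTo-zero : ∀ B {a : ℕ → ℤ} → (∀ x → x ℕ.< B → a x ≡ + 0) → sumTo B a ≡ + 0
sumTo-zero zero    a≡0 = refl
sumTo-zero (suc B) a≡0 =
  cong₂ _+_ (sumTo-zero B (λ x → a≡0 x ∘ ℕ.m≤n⇒m≤1+n)) (a≡0 B ℕ.≤-refl)

sumTo-delta : ∀ {B c} {a : ℕ → ℤ} → c ℕ.< B → (∀ x → x ≢ c → a x ≡ + 0) → sumTo B a ≡ a c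
sumTo-delta {suc B} {c} {a} c<1+B off with c ℕ.≟ B
... | yes refl = begin
  sumTo c a + a c ≡⟨ cong (_+ a c) (sumTo-zero c (λ x x<c → off x (ℕ.<⇒≢ x<c))) ⟩
  + 0 + a c       ≡⟨ ℤ.+-identityˡ (a c) ⟩
  a c             ∎
... | no c≢B = begin
  sumTo B a + a B ≡⟨ cong₂ _+_ (sumTo-delta (ℕ.≤∧≢⇒< (ℕ.≤-pred c<1+B) c≢B) off)
                               (off B (c≢B ∘ sym)) ⟩
  a c + + 0       ≡⟨ ℤ.+-identityʳ (a c) ⟩
  a c             ∎

sumTo-extend : ∀ {B C} {a : ℕ → ℤ} → B ℕ.≤ C → (∀ x → B ℕ.≤ x → a x ≡ + 0) →
               sumTo C a ≡ sumTo B a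
sumTo-extend {B} {a = a} B≤C vanish = extend (ℕ.≤⇒≤′ B≤C)
  where
  extend : ∀ {C} → B ≤′ C → sumTo C a ≡ sumTo B a
  extend ≤′-refl                = refl
  extend {suc C} (≤′-step B≤′C) = begin
    sumTo C a + a C ≡⟨ cong₂ _+_ (extend B≤′C) (vanish C (ℕ.≤′⇒≤ B≤′C)) ⟩
    sumTo B a + + 0 ≡⟨ ℤ.+-identityʳ (sumTo B a) ⟩
    sumTo B a       ∎

sumTo-linear : ∀ B (a b : ℕ → ℤ) c → sumTo B (λ x → a x - c * b x) ≡ sumTo B a - c * sumTo B b
sumTo-linear zero    a b c = regroup-zero c
  where
  regroup-zero : ∀ c → + 0 ≡ + 0 - c * + 0
  regroup-zero = ℤ-Solver.solve-∀
sumTo-linear (suc B) a b c = begin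
  sumTo B (λ x → a x - c * b x) + (a B - c * b B)
    ≡⟨ cong (_+ (a B - c * b B)) (sumTo-linear B a b c) ⟩
  sumTo B a - c * sumTo B b + (a B - c * b B)
    ≡⟨ regroup (sumTo B a) (sumTo B b) (a B) (b B) c ⟩
  sumTo B a + a B - c * (sumTo B b + b B) ∎
  where
  regroup : ∀ s t x y c → s - c * t + (x - c * y) ≡ s + x - c * (t + y)
  regroup = ℤ-Solver.solve-∀

sumTo-scale : ∀ B (a : ℕ → ℤ) c → sumTo B (λ x → c * a x) ≡ c * sumTo B a
sumTo-scale zero    a c = sym (ℤ.*-zeroʳ c)
sumTo-scale (suc B) a c = begin
  sumTo B (λ x → c * a x) + c * a B ≡⟨ cong (_+ c * a B) (sumTo-scale B a c) ⟩
  c * sumTo B a + c * a B           ≡⟨ ℤ.*-distribˡ-+ c (sumTo B a) (a B) ⟨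
  c * (sumTo B a + a B)             ∎

sumTo-telescope : ∀ K r (E : ℕ → ℤ) →
                  sumTo K (λ k → r ^ k * (E k - r * E (suc k))) ≡ E 0 - r ^ K * E K
sumTo-telescope zero    r E = cancel (E 0)
  where
  cancel : ∀ e → + 0 ≡ e - + 1 * e
  cancel = ℤ-Solver.solve-∀
sumTo-telescope (suc K) r E = begin
  sumTo K (λ k → r ^ k * (E k - r * E (suc k))) + r ^ K * (E K - r * E (suc K))
    ≡⟨ cong (_+ r ^ K * (E K - r * E (suc K))) (sumTo-telescope K r E) ⟩
  E 0 - r ^ K * E K + r ^ K * (E K - r * E (suc K))
    ≡⟨ cancel (E 0) (r ^ K) (E K) r (E (suc K)) ⟩
  E 0 - r * r ^ K * E (suc K) ∎
  where
  cancel : ∀ e₀ p e r e′ → e₀ - p * e + p * (e - r * e′) ≡ e₀ - r * p * e′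
  cancel = ℤ-Solver.solve-∀

sumTo-telescope-vanishing : ∀ K r (E : ℕ → ℤ) → E K ≡ + 0 →
                            sumTo K (λ k → r ^ k * (E k - r * E (suc k))) ≡ E 0
sumTo-telescope-vanishing K r E E_K≡0 = begin
  sumTo K (λ k → r ^ k * (E k - r * E (suc k))) ≡⟨ sumTo-telescope K r E ⟩
  E 0 - r ^ K * E K                             ≡⟨ cong (λ e → E 0 - r ^ K * e) E_K≡0 ⟩
  E 0 - r ^ K * + 0                             ≡⟨ drop-zero (E 0) (r ^ K) ⟩
  E 0                                           ∎
  where
  drop-zero : ∀ e p → e - p * + 0 ≡ e
  drop-zero = ℤ-Solver.solve-∀

ind-hit : ∀ {a b} → a ≡ b → ind a b ≡ + 1
ind-hit {a} {b} a≡b with a ℕ.≟ b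
... | yes _   = refl
... | no a≢b = contradiction a≡b a≢b

ind-miss : ∀ {a b} → a ≢ b → ind a b ≡ + 0
ind-miss {a} {b} a≢b with a ℕ.≟ b
... | yes a≡b = contradiction a≡b a≢b
... | no _    = refl

record Expanding (p : ℕ → ℕ) : Set where
  field
    injective    : ∀ {x y} → p x ≡ p y → x ≡ y
    inflationary : ∀ x → x ℕ.≤ p x

open Expanding

data Fibre (p : ℕ → ℕ) (N : ℕ) : Set where
  hit  : ∀ a → p a ≡ N → Fibre p N
  miss : (∀ x → p x ≢ N) → Fibre p N

fibre : ∀ {p} → Expanding p → ∀ N → Fibre p N
fibre {p} p-exp N with ℕ.anyUpTo? (λ x → p x ℕ.≟ N) (suc N)
... | yes (a , _ , pa≡N) = hit a pa≡N
... | no none = miss (λ x px≡N → none (x , s≤s (subst (x ℕ.≤_) px≡N (inflationary p-exp x)) , px≡N))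

sumUpTo-fibre-hit : ∀ {p N a} {c : ℕ → ℤ} → Expanding p → p a ≡ N →
                    (∀ x → p x ≢ N → c x ≡ + 0) → sumUpTo N c ≡ c a
sumUpTo-fibre-hit {a = a} p-exp pa≡N off = sumTo-delta
  (s≤s (subst (a ℕ.≤_) pa≡N (inflationary p-exp a)))
  (λ x x≢a → off x (λ px≡N → x≢a (injective p-exp (trans px≡N (sym pa≡N)))))

multiples-expanding : ∀ i .{{_ : NonZero i}} → Expanding (λ m → i ℕ.* suc m)
multiples-expanding i = record
  { injective    = λ {x} {y} e → ℕ.suc-injective (ℕ.*-cancelˡ-≡ (suc x) (suc y) i e)
  ; inflationary = λ x → ℕ.≤-trans (ℕ.n≤1+n x) (ℕ.m≤n*m (suc x) i)
  }

*-expanding : ∀ k .{{_ : NonZero k}} → Expanding (k ℕ.*_)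
*-expanding k = record
  { injective    = λ {x} {y} → ℕ.*-cancelˡ-≡ x y k
  ; inflationary = λ x → ℕ.m≤n*m x k
  }

data EvenOdd : ℕ → Set where
  even : ∀ t → EvenOdd (2 ℕ.* t)
  odd  : ∀ t → EvenOdd (suc (2 ℕ.* t))

evenOdd : ∀ m → EvenOdd m
evenOdd zero = even 0
evenOdd (suc m) with evenOdd m
... | even t = odd t
... | odd t  = subst EvenOdd (cong suc (ℕ.+-suc t (t ℕ.+ 0))) (even (suc t))

-1^even : ∀ t → (- + 1) ^ (2 ℕ.* t) ≡ + 1
-1^even t = trans (sym (ℤ.^-*-assoc (- + 1) 2 t)) (ℤ.^-zeroˡ t)

-1^odd : ∀ t → (- + 1) ^ suc (2 ℕ.* t) ≡ - + 1
-1^odd t = cong (- + 1 *_) (-1^even t)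

multiple-odd-index : ∀ i x → i ℕ.* suc (suc (2 ℕ.* x)) ≡ 2 ℕ.* (i ℕ.* suc x)
multiple-odd-index = ℕ-Solver.solve-∀

module _ (i : ℕ) .{{_ : NonZero i}} where

  geomMinus-hit : ∀ {m N} → i ℕ.* suc m ≡ N → geomMinus i N ≡ + 1
  geomMinus-hit im≡N = trans (sumUpTo-fibre-hit (multiples-expanding i) im≡N (λ _ → ind-miss))
                             (ind-hit im≡N)

  geomMinus-miss : ∀ {N} → (∀ m → i ℕ.* suc m ≢ N) → geomMinus i N ≡ + 0
  geomMinus-miss {N} none = sumTo-zero (suc N) (λ m _ → ind-miss (none m))

  signed-term-miss : ∀ m {N} → i ℕ.* suc m ≢ N → (- + 1) ^ m * ind (i ℕ.* suc m) N ≡ + 0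
  signed-term-miss m im≢N = trans (cong ((- + 1) ^ m *_) (ind-miss im≢N)) (ℤ.*-zeroʳ ((- + 1) ^ m))

  geomPlus-hit : ∀ {m N} → i ℕ.* suc m ≡ N → geomPlus i N ≡ (- + 1) ^ m
  geomPlus-hit {m} {N} im≡N = begin
    geomPlus i N
      ≡⟨ sumUpTo-fibre-hit (multiples-expanding i) im≡N (λ x → signed-term-miss x) ⟩
    (- + 1) ^ m * ind (i ℕ.* suc m) N ≡⟨ cong ((- + 1) ^ m *_) (ind-hit im≡N) ⟩
    (- + 1) ^ m * + 1                  ≡⟨ ℤ.*-identityʳ _ ⟩
    (- + 1) ^ m                        ∎

  geomPlus-miss : ∀ {N} → (∀ m → i ℕ.* suc m ≢ N) → geomPlus i N ≡ + 0
  geomPlus-miss {N} none = sumTo-zero (suc N) (λ m _ → signed-term-miss m (none m))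

  multiple-doubled : ∀ {x l N} → i ℕ.* suc x ≡ l → 2 ℕ.* l ≡ N → i ℕ.* suc (suc (2 ℕ.* x)) ≡ N
  multiple-doubled {x} ix≡l 2l≡N = trans (multiple-odd-index i x) (trans (cong (2 ℕ.*_) ix≡l) 2l≡N)

  -- The sign (-1)^m of the term at N = i(m+1) is negative exactly when N/2 = i(m+1)/2 is
  -- itself a multiple of i, and those are the terms that -2 q^{2i}/(1-q^{2i}) accounts for.
  geomPlus-even : ∀ {N l} → 2 ℕ.* l ≡ N → geomPlus i N ≡ geomMinus i N - + 2 * geomMinus i l
  geomPlus-even {N} {l} 2l≡N with fibre (multiples-expanding i) N
  ... | hit m im≡N with evenOdd m
  ...   | even t rewrite geomPlus-hit im≡N | -1^even t | geomMinus-hit im≡N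
                       | geomMinus-miss {l} (λ x ix≡l → ℕ.even≢odd t x
                           (injective (multiples-expanding i)
                             (trans im≡N (sym (multiple-doubled ix≡l 2l≡N))))) = refl
  ...   | odd t rewrite geomPlus-hit im≡N | -1^odd t | geomMinus-hit im≡N
                      | geomMinus-hit {t} {l} (ℕ.*-cancelˡ-≡ _ _ 2
                          (trans (sym (multiple-odd-index i t)) (trans im≡N (sym 2l≡N)))) = refl
  geomPlus-even {N} {l} 2l≡N | miss none
    rewrite geomPlus-miss none | geomMinus-miss none
          | geomMinus-miss {l} (λ x ix≡l → none (suc (2 ℕ.* x)) (multiple-doubled ix≡l 2l≡N)) = refl

  geomPlus-odd : ∀ {N} → (∀ l → 2 ℕ.* l ≢ N) → geomPlus i N ≡ geomMinus i N
  geomPlus-odd {N} odd-N with fibre (multiples-expanding i) N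
  ... | hit m im≡N with evenOdd m
  ...   | even t rewrite geomPlus-hit im≡N | -1^even t | geomMinus-hit im≡N = refl
  ...   | odd t = contradiction (trans (sym (multiple-odd-index i t)) im≡N) (odd-N (i ℕ.* suc t))
  geomPlus-odd {N} odd-N | miss none rewrite geomPlus-miss none | geomMinus-miss none = refl

fTerm gTerm : ℕ → FPS
fTerm n N = + n * (if ⌊ n ℕ.≟ 0 ⌋ then + 0 else geomMinus n N)
gTerm n N = + n * (if ⌊ n ℕ.≟ 0 ⌋ then + 0 else geomPlus n N)

fTerm-order : ∀ {n N} → N ℕ.< n → fTerm n N ≡ + 0
fTerm-order {suc n} N<n = trans (cong (+ suc n *_) (geomMinus-miss (suc n) λ m nm≡N →
  ℕ.<⇒≱ N<n (subst (suc n ℕ.≤_) nm≡N (ℕ.m≤m*n (suc n) (suc m))))) (ℤ.*-zeroʳ (+ suc n))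

gTerm-even : ∀ n {N l} → 2 ℕ.* l ≡ N → gTerm n N ≡ fTerm n N - + 2 * fTerm n l
gTerm-even zero    2l≡N = refl
gTerm-even (suc n) {N} {l} 2l≡N = trans (cong (+ suc n *_) (geomPlus-even (suc n) {N} {l} 2l≡N))
  (distribute (+ suc n) (geomMinus (suc n) N) (geomMinus (suc n) l))
  where
  distribute : ∀ x a b → x * (a - + 2 * b) ≡ x * a - + 2 * (x * b)
  distribute = ℤ-Solver.solve-∀

gTerm-odd : ∀ n {N} → (∀ l → 2 ℕ.* l ≢ N) → gTerm n N ≡ fTerm n N
gTerm-odd zero    odd-N = refl
gTerm-odd (suc n) odd-N = cong (+ suc n *_) (geomPlus-odd (suc n) odd-N)

f-truncate : ∀ {l B} → l ℕ.< B → sumTo B (λ n → fTerm n l) ≡ f l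
f-truncate l<B = sumTo-extend l<B (λ n → fTerm-order)

substPow-hit : ∀ k .{{_ : NonZero k}} (F : FPS) {a N} → k ℕ.* a ≡ N → substPow k F N ≡ F a
substPow-hit k F {a} {N} ka≡N = begin
  substPow k F N         ≡⟨ sumUpTo-fibre-hit (*-expanding k) ka≡N
                              (λ x kx≢N → trans (cong (_* F x) (ind-miss kx≢N)) (ℤ.*-zeroˡ (F x))) ⟩
  ind (k ℕ.* a) N * F a ≡⟨ cong (_* F a) (ind-hit ka≡N) ⟩
  + 1 * F a              ≡⟨ ℤ.*-identityˡ (F a) ⟩
  F a                    ∎

substPow-miss : ∀ k (F : FPS) {N} → (∀ x → k ℕ.* x ≢ N) → substPow k F N ≡ + 0
substPow-miss k F {N} none =
  sumTo-zero (suc N) (λ x _ → trans (cong (_* F x) (ind-miss (none x))) (ℤ.*-zeroˡ (F x)))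

substPow-one : ∀ (F : FPS) N → substPow 1 F N ≡ F N
substPow-one F N = substPow-hit 1 F (ℕ.*-identityˡ N)

substPow-order : ∀ k .{{_ : NonZero k}} (F : FPS) {N} → F 0 ≡ + 0 → N ℕ.< k → substPow k F N ≡ + 0
substPow-order k F {N} F₀≡0 N<k with fibre (*-expanding k) N
... | hit zero    k0≡N = trans (substPow-hit k F k0≡N) F₀≡0
... | hit (suc a) ka≡N = contradiction (subst (k ℕ.≤_) ka≡N (ℕ.m≤m*n k (suc a))) (ℕ.<⇒≱ N<k)
... | miss none        = substPow-miss k F none

substPow-cong : ∀ k {F G : FPS} → (∀ M → F M ≡ G M) → ∀ N → substPow k F N ≡ substPow k G N
substPow-cong k F≡G N = sumTo-cong (suc N) (λ x → cong (ind (k ℕ.* x) N *_) (F≡G x))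

substPow-linear : ∀ k (F G : FPS) c N →
                  substPow k (λ M → F M - c * G M) N ≡ substPow k F N - c * substPow k G N
substPow-linear k F G c N = begin
  substPow k (λ M → F M - c * G M) N
    ≡⟨ sumTo-cong (suc N) (λ x → distribute (ind (k ℕ.* x) N) (F x) (G x) c) ⟩
  sumUpTo N (λ x → ind (k ℕ.* x) N * F x - c * (ind (k ℕ.* x) N * G x))
    ≡⟨ sumTo-linear (suc N) _ _ c ⟩
  substPow k F N - c * substPow k G N ∎
  where
  distribute : ∀ e a b c → e * (a - c * b) ≡ e * a - c * (e * b)
  distribute = ℤ-Solver.solve-∀

m*k*x≡k*[m*x] : ∀ m k x → m ℕ.* k ℕ.* x ≡ k ℕ.* (m ℕ.* x)
m*k*x≡k*[m*x] = ℕ-Solver.solve-∀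

substPow-substPow : ∀ m k .{{_ : NonZero m}} .{{_ : NonZero k}} (F : FPS) N →
                    substPow k (substPow m F) N ≡ substPow (m ℕ.* k) F N
substPow-substPow m k F N with fibre (*-expanding k) N
... | hit a ka≡N with fibre (*-expanding m) a
...   | hit b mb≡a = begin
  substPow k (substPow m F) N ≡⟨ substPow-hit k (substPow m F) ka≡N ⟩
  substPow m F a              ≡⟨ substPow-hit m F mb≡a ⟩
  F b                         ≡⟨ substPow-hit (m ℕ.* k) {{ℕ.m*n≢0 m k}} F
                                   (trans (m*k*x≡k*[m*x] m k b) (trans (cong (k ℕ.*_) mb≡a) ka≡N)) ⟨
  substPow (m ℕ.* k) F N      ∎
...   | miss none = begin
  substPow k (substPow m F) N ≡⟨ substPow-hit k (substPow m F) ka≡N ⟩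
  substPow m F a              ≡⟨ substPow-miss m F none ⟩
  + 0                         ≡⟨ substPow-miss (m ℕ.* k) F (λ x mkx≡N → none x
                                   (ℕ.*-cancelˡ-≡ _ _ k (trans (sym (m*k*x≡k*[m*x] m k x))
                                                             (trans mkx≡N (sym ka≡N))))) ⟨
  substPow (m ℕ.* k) F N      ∎
substPow-substPow m k F N | miss none = begin
  substPow k (substPow m F) N ≡⟨ substPow-miss k (substPow m F) none ⟩
  + 0                         ≡⟨ substPow-miss (m ℕ.* k) F (λ x mkx≡N → none (m ℕ.* x)
                                   (trans (sym (m*k*x≡k*[m*x] m k x)) mkx≡N)) ⟨
  substPow (m ℕ.* k) F N      ∎

g-via-f : ∀ N → g N ≡ f N - + 2 * substPow 2 f N
g-via-f N with fibre (*-expanding 2) N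
... | hit l 2l≡N = begin
  g N                                           ≡⟨ sumTo-cong (suc N) (λ n → gTerm-even n {N} {l} 2l≡N) ⟩
  sumUpTo N (λ n → fTerm n N - + 2 * fTerm n l) ≡⟨ sumTo-linear (suc N) _ _ (+ 2) ⟩
  f N - + 2 * sumUpTo N (λ n → fTerm n l)       ≡⟨ cong (λ s → f N - + 2 * s) (f-truncate l<1+N) ⟩
  f N - + 2 * f l                               ≡⟨ cong (λ s → f N - + 2 * s) (substPow-hit 2 f {l} 2l≡N) ⟨
  f N - + 2 * substPow 2 f N                    ∎
  where
  l<1+N : l ℕ.< suc N
  l<1+N = s≤s (subst (l ℕ.≤_) 2l≡N (inflationary (*-expanding 2) l))
... | miss none = begin
  g N                        ≡⟨ sumTo-cong (suc N) (λ n → gTerm-odd n none) ⟩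
  f N                        ≡⟨ minus-zero (f N) ⟨
  f N - + 2 * + 0            ≡⟨ cong (λ s → f N - + 2 * s) (substPow-miss 2 f none) ⟨
  f N - + 2 * substPow 2 f N ∎
  where
  minus-zero : ∀ a → a - + 2 * + 0 ≡ a
  minus-zero = ℤ-Solver.solve-∀

g-dilated : ∀ k .{{_ : NonZero k}} N →
            substPow k g N ≡ substPow k f N - + 2 * substPow (2 ℕ.* k) f N
g-dilated k N = begin
  substPow k g N                                     ≡⟨ substPow-cong k g-via-f N ⟩
  substPow k (λ M → f M - + 2 * substPow 2 f M) N    ≡⟨ substPow-linear k f (substPow 2 f) (+ 2) N ⟩
  substPow k f N - + 2 * substPow k (substPow 2 f) N ≡⟨ cong (λ s → substPow k f N - + 2 * s)
                                                          (substPow-substPow 2 k f N) ⟩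
  substPow k f N - + 2 * substPow (2 ℕ.* k) f N      ∎

n<2^n : ∀ n → n ℕ.< 2 ℕ.^ n
n<2^n zero    = s≤s z≤n
n<2^n (suc n) = ℕ.+-mono-≤ (ℕ.m^n>0 2 n) (ℕ.≤-trans (n<2^n n) (ℕ.m≤m+n (2 ℕ.^ n) 0))

2^[2j+k]≡4^j*2^k : ∀ j k → (+ 2) ^ (2 ℕ.* j ℕ.+ k) ≡ (+ 4) ^ j * (+ 2) ^ k
2^[2j+k]≡4^j*2^k j k = trans (ℤ.^-distribˡ-+-* (+ 2) (2 ℕ.* j) k)
                     (cong (_* (+ 2) ^ k) (sym (ℤ.^-*-assoc (+ 2) 2 j)))

module Dyadic (N : ℕ) where

  B A D : ℕ → ℤ
  B s = substPow (2 ℕ.^ s) f N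
  A s = substPow (2 ℕ.^ s) g N
  D s = B s - + 4 * B (suc s)

  A-via-B : ∀ s → A s ≡ B s - + 2 * B (suc s)
  A-via-B s = g-dilated (2 ℕ.^ s) {{ℕ.m^n≢0 2 s}} N

  B-order : ∀ {s} → N ℕ.< s → B s ≡ + 0
  B-order {s} N<s = substPow-order (2 ℕ.^ s) {{ℕ.m^n≢0 2 s}} f refl (ℕ.<-trans N<s (n<2^n s))

  D-order : ∀ {s} → N ℕ.< s → D s ≡ + 0
  D-order N<s = cong₂ (λ b b′ → b - + 4 * b′) (B-order N<s) (B-order (ℕ.m<n⇒m<1+n N<s))

  rhs-term : ∀ j k → (+ 2) ^ (2 ℕ.* j ℕ.+ k) * (A (j ℕ.+ k) - + 4 * A (j ℕ.+ k ℕ.+ 1))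
                     ≡ (+ 4) ^ j * ((+ 2) ^ k * (D (j ℕ.+ k) - + 2 * D (j ℕ.+ suc k)))
  rhs-term j k = begin
    (+ 2) ^ (2 ℕ.* j ℕ.+ k) * (A s - + 4 * A (s ℕ.+ 1))
      ≡⟨ cong₂ (λ p s′ → p * (A s - + 4 * A s′)) (2^[2j+k]≡4^j*2^k j k) (ℕ.+-comm s 1) ⟩
    (+ 4) ^ j * (+ 2) ^ k * (A s - + 4 * A (suc s))
      ≡⟨ cong₂ (λ a a′ → (+ 4) ^ j * (+ 2) ^ k * (a - + 4 * a′)) (A-via-B s) (A-via-B (suc s)) ⟩
    (+ 4) ^ j * (+ 2) ^ k * (B s - + 2 * B (suc s) - + 4 * (B (suc s) - + 2 * B (suc (suc s))))
      ≡⟨ regroup ((+ 4) ^ j) ((+ 2) ^ k) (B s) (B (suc s)) (B (suc (suc s))) ⟩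
    (+ 4) ^ j * ((+ 2) ^ k * (D s - + 2 * D (suc s)))
      ≡⟨ cong (λ s′ → (+ 4) ^ j * ((+ 2) ^ k * (D s - + 2 * D s′))) (ℕ.+-suc j k) ⟨
    (+ 4) ^ j * ((+ 2) ^ k * (D s - + 2 * D (j ℕ.+ suc k))) ∎
    where
    s = j ℕ.+ k
    regroup : ∀ p r b₀ b₁ b₂ → p * r * (b₀ - + 2 * b₁ - + 4 * (b₁ - + 2 * b₂))
                              ≡ p * (r * (b₀ - + 4 * b₁ - + 2 * (b₁ - + 4 * b₂)))
    regroup = ℤ-Solver.solve-∀

  rhs-row : ∀ j →
            sumUpTo N (λ k → (+ 2) ^ (2 ℕ.* j ℕ.+ k) * (A (j ℕ.+ k) - + 4 * A (j ℕ.+ k ℕ.+ 1)))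
            ≡ (+ 4) ^ j * D j
  rhs-row j = begin
    sumUpTo N (λ k → (+ 2) ^ (2 ℕ.* j ℕ.+ k) * (A (j ℕ.+ k) - + 4 * A (j ℕ.+ k ℕ.+ 1)))
      ≡⟨ sumTo-cong (suc N) (rhs-term j) ⟩
    sumUpTo N (λ k → (+ 4) ^ j * ((+ 2) ^ k * (D (j ℕ.+ k) - + 2 * D (j ℕ.+ suc k))))
      ≡⟨ sumTo-scale (suc N) _ ((+ 4) ^ j) ⟩
    (+ 4) ^ j * sumUpTo N (λ k → (+ 2) ^ k * (D (j ℕ.+ k) - + 2 * D (j ℕ.+ suc k)))
      ≡⟨ cong ((+ 4) ^ j *_) (sumTo-telescope-vanishing (suc N) (+ 2) (D ∘ (j ℕ.+_))
                                (D-order (ℕ.m≤n+m (suc N) j))) ⟩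
    (+ 4) ^ j * D (j ℕ.+ 0)
      ≡⟨ cong (λ s → (+ 4) ^ j * D s) (ℕ.+-identityʳ j) ⟩
    (+ 4) ^ j * D j ∎

mainTheorem6 : (N : ℕ) → f N ≡ rhs N
mainTheorem6 N = sym (begin
  rhs N                             ≡⟨ sumTo-cong (suc N) rhs-row ⟩
  sumUpTo N (λ j → (+ 4) ^ j * D j) ≡⟨ sumTo-telescope-vanishing (suc N) (+ 4) B (B-order ℕ.≤-refl) ⟩
  B 0                               ≡⟨ substPow-one f N ⟩
  f N                               ∎)
  where open Dyadic N
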